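{- Let $q$ be a prime, let $s \in \mathbb{Z}_q^*$ with $\operatorname{ord}_q(s) = m$, and let $A = (a_0, a_1, \dots, a_{m-1})$ be a sequence in $\mathbb{Z}_q$ with $a_i \not\equiv a_j \pmod q$ for some indices $0 \le i, j \le m-1$. Then $$\sum_{k=0}^{m-1} a_ks^k \not\equiv a_is^j + a_js^i + \sum_{\substack{k=0 \\ k \neq i, j}}^{m-1} a_ks^k \pmod q.$$ In particular, if one of these two expressions is $0$ modulo $q$, then the other is not $0$ modulo $q$.
   Context: $\operatorname{ord}_q(s)$ denotes the multiplicative order of $s$ modulo $q$. -}

module Defs where

open import Data.Nat as ℕ using (ℕ; zero; suc)
open import Data.Integer using (ℤ; +_; _+_; _-_; _*_; _^_)
open import Data.Integer.Divisibility using (_∣_)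
open import Data.Fin using (Fin; toℕ)
open import Data.Fin.Properties using (_≟_)
open import Data.Product using (_×_)
open import Relation.Nullary using (¬_; yes; no)

_≡_[mod_] : ℤ → ℤ → ℕ → Set
x ≡ y [mod q ] = (+ q) ∣ (x - y)

IsOrd : ℕ → ℤ → ℕ → Set
IsOrd q s m =
  (0 ℕ.< m) × ((s ^ m) ≡ + 1 [mod q ]) ×
  (∀ k → 0 ℕ.< k → k ℕ.< m → ¬ ((s ^ k) ≡ + 1 [mod q ]))

∑ : (n : ℕ) → (Fin n → ℤ) → ℤ
∑ zero    f = + 0
∑ (suc n) f = f Fin.zero + ∑ n (λ k → f (Fin.suc k))
  where import Data.Fin as Fin

∑-except : (n : ℕ) → Fin n → Fin n → (Fin n → ℤ) → ℤ
∑-except n i j f = ∑ n g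
  where
  g : Fin n → ℤ
  g k with k ≟ i | k ≟ j
  ... | yes _ | _     = + 0
  ... | no _  | yes _ = + 0
  ... | no _  | no _  = f k

{-# OPTIONS --safe #-}
-- Subtracting the right-hand side from the left leaves only the two swapped terms:
-- lhs - rhs = (a_i - a_j)(s^i - s^j). Since q is prime it would have to divide a
-- factor; it does not divide a_i - a_j by hypothesis, and it does not divide
-- s^i - s^j = ± s^i (s^(j-i) - 1), because q ∤ s and 0 < |j - i| < ord_q(s).
module Submission where

open import Defs
open import Data.Nat using (ℕ)
open import Data.Nat.Primality using (Prime)
open import Data.Integer using (ℤ; +_; _+_; _*_; _^_)
open import Data.Fin using (Fin; toℕ)
open import Data.Product using (_×_)
open import Relation.Nullary using (¬_)

import Data.Nat as ℕ
import Data.Nat.Properties as ℕ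
import Data.Nat.Divisibility as ℕ
import Data.Nat.Primality as ℕ
import Data.Integer as ℤ
import Data.Integer.Properties as ℤ
open import Data.Integer.Divisibility using (_∣_)
import Data.Integer.Divisibility.Signed as Signed
open import Data.Integer.Solver using (module +-*-Solver)
open import Data.Fin as Fin using (suc)
open import Data.Fin.Properties using (_≟_; toℕ-injective; toℕ<n)
open import Data.Product using (_,_; proj₂)
open import Data.Sum using (_⊎_; inj₁; inj₂)
open import Relation.Nullary using (yes; no; contradiction)
open import Relation.Binary.PropositionalEquality
open import Relation.Binary.Definitions using (tri<; tri≈; tri>)

open +-*-Solver

∑-cong : ∀ n {f g : Fin n → ℤ} → (∀ k → f k ≡ g k) → ∑ n f ≡ ∑ n g
∑-cong ℕ.zero    f≗g = refl
∑-cong (ℕ.suc n) f≗g = cong₂ _+_ (f≗g Fin.zero) (∑-cong n (λ k → f≗g (suc k)))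

∑-+ : ∀ n (f g : Fin n → ℤ) → ∑ n (λ k → f k + g k) ≡ ∑ n f + ∑ n g
∑-+ ℕ.zero    f g = refl
∑-+ (ℕ.suc n) f g = begin
  (f Fin.zero + g Fin.zero) + ∑ n (λ k → f (suc k) + g (suc k))
    ≡⟨ cong (_+_ (f Fin.zero + g Fin.zero)) (∑-+ n (f ∘suc) (g ∘suc)) ⟩
  (f Fin.zero + g Fin.zero) + (∑ n (f ∘suc) + ∑ n (g ∘suc))
    ≡⟨ interchange (f Fin.zero) (g Fin.zero) _ _ ⟩
  (f Fin.zero + ∑ n (f ∘suc)) + (g Fin.zero + ∑ n (g ∘suc)) ∎
  where
  open ≡-Reasoning
  _∘suc : (Fin (ℕ.suc n) → ℤ) → Fin n → ℤ
  h ∘suc = λ k → h (suc k)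
  interchange : ∀ a b c d → (a + b) + (c + d) ≡ (a + c) + (b + d)
  interchange = solve 4 (λ a b c d → (a :+ b) :+ (c :+ d) := (a :+ c) :+ (b :+ d)) refl

∑-0 : ∀ n → ∑ n (λ _ → + 0) ≡ + 0
∑-0 ℕ.zero    = refl
∑-0 (ℕ.suc n) = trans (ℤ.+-identityˡ _) (∑-0 n)

δ : ∀ {n} → Fin n → ℤ → Fin n → ℤ
δ i c k with k ≟ i
... | yes _ = c
... | no  _ = + 0

δ-suc : ∀ {n} (i : Fin n) c k → δ (suc i) c (suc k) ≡ δ i c k
δ-suc i c k with k ≟ i
... | yes _ = refl
... | no  _ = refl

∑-δ : ∀ n (i : Fin n) c → ∑ n (δ i c) ≡ c
∑-δ (ℕ.suc n) Fin.zero c = trans (cong (_+_ c) (∑-0 n)) (ℤ.+-identityʳ c)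
∑-δ (ℕ.suc n) (suc i)  c =
  trans (ℤ.+-identityˡ _) (trans (∑-cong n (δ-suc i c)) (∑-δ n i c))

-- The summand of ∑-except, which Defs hides in a where block.
except : ∀ {n} (i j : Fin n) (f : Fin n → ℤ) → Fin n → ℤ
except i j f k with k ≟ i | k ≟ j
... | yes _ | _     = + 0
... | no  _ | yes _ = + 0
... | no  _ | no  _ = f k

-- The meta on the left is solved by the use below, which is checked before the clauses.
∑-except-summand : ∀ {n} (i j : Fin n) (f : Fin n → ℤ) k → _ ≡ except i j f k

∑-except≡∑-except : ∀ n i j f → ∑-except n i j f ≡ ∑ n (except i j f)
∑-except≡∑-except n i j f = ∑-cong n (∑-except-summand i j f)

∑-except-summand i j f k with k ≟ i | k ≟ j
... | yes _ | _     = refl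
... | no  _ | yes _ = refl
... | no  _ | no  _ = refl

except+δ+δ : ∀ {n} {i j : Fin n} (f : Fin n → ℤ) → i ≢ j → ∀ k →
  f k ≡ (except i j f k + δ i (f i) k) + δ j (f j) k
except+δ+δ {i = i} {j} f i≢j k with k ≟ i | k ≟ j
... | yes refl | yes refl = contradiction refl i≢j
... | yes refl | no  _    = sym (trans (ℤ.+-identityʳ _) (ℤ.+-identityˡ _))
... | no  _    | yes refl = sym (ℤ.+-identityˡ _)
... | no  _    | no  _    = sym (trans (ℤ.+-identityʳ _) (ℤ.+-identityʳ _))

∑≡∑-except+ : ∀ n {i j : Fin n} (f : Fin n → ℤ) → i ≢ j →
  ∑ n f ≡ (∑-except n i j f + f i) + f j
∑≡∑-except+ n {i} {j} f i≢j = begin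
  ∑ n f
    ≡⟨ ∑-cong n (except+δ+δ f i≢j) ⟩
  ∑ n (λ k → (except i j f k + δ i (f i) k) + δ j (f j) k)
    ≡⟨ ∑-+ n _ _ ⟩
  ∑ n (λ k → except i j f k + δ i (f i) k) + ∑ n (δ j (f j))
    ≡⟨ cong₂ _+_ (∑-+ n _ _) (∑-δ n j (f j)) ⟩
  (∑ n (except i j f) + ∑ n (δ i (f i))) + f j
    ≡⟨ cong (_+ f j) (cong₂ _+_ (sym (∑-except≡∑-except n i j f)) (∑-δ n i (f i))) ⟩
  (∑-except n i j f + f i) + f j ∎
  where open ≡-Reasoning

module _ {q : ℕ} where

  ≡-mod-refl : ∀ x → x ≡ x [mod q ]
  ≡-mod-refl x = subst (+ q ∣_) (sym (ℤ.+-inverseʳ x)) (q ℕ.∣0)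

  ≡-mod-sym : ∀ x y → x ≡ y [mod q ] → y ≡ x [mod q ]
  ≡-mod-sym x y x≡y = subst (+ q ∣_) (neg-diff x y)
    (Signed.∣⇒∣ᵤ (Signed.∣m⇒∣-m (Signed.∣ᵤ⇒∣ {+ q} {x ℤ.- y} x≡y)))
    where
    neg-diff : ∀ u v → ℤ.- (u ℤ.- v) ≡ v ℤ.- u
    neg-diff = solve 2 (λ u v → :- (u :- v) := v :- u) refl

  ≡-mod-trans : ∀ x y z → x ≡ y [mod q ] → y ≡ z [mod q ] → x ≡ z [mod q ]
  ≡-mod-trans x y z x≡y y≡z = subst (+ q ∣_) (telescope x y z)
    (Signed.∣⇒∣ᵤ (Signed.∣m∣n⇒∣m+n (Signed.∣ᵤ⇒∣ {+ q} {x ℤ.- y} x≡y)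
                                   (Signed.∣ᵤ⇒∣ {+ q} {y ℤ.- z} y≡z)))
    where
    telescope : ∀ u v w → (u ℤ.- v) + (v ℤ.- w) ≡ u ℤ.- w
    telescope = solve 3 (λ u v w → (u :- v) :+ (v :- w) := u :- w) refl

  ≡0∧≡0⇒≡ : ∀ x y → x ≡ + 0 [mod q ] → y ≡ + 0 [mod q ] → x ≡ y [mod q ]
  ≡0∧≡0⇒≡ x y x≡0 y≡0 = ≡-mod-trans x (+ 0) y x≡0 (≡-mod-sym y (+ 0) y≡0)

module _ {q : ℕ} (q-prime : Prime q) where

  prime∣*⇒∣⊎∣ : ∀ x y → + q ∣ x * y → + q ∣ x ⊎ + q ∣ y
  prime∣*⇒∣⊎∣ x y q∣xy =
    ℕ.euclidsLemma ℤ.∣ x ∣ ℤ.∣ y ∣ q-prime (subst (q ℕ.∣_) (ℤ.abs-* x y) q∣xy)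

  prime∤1 : ¬ + q ∣ + 1
  prime∤1 q∣1 = ℕ.¬prime[1] (subst Prime (ℕ.∣1⇒≡1 q∣1) q-prime)

  prime∣^⇒∣ : ∀ s e → + q ∣ s ^ e → + q ∣ s
  prime∣^⇒∣ s ℕ.zero    q∣1   = contradiction q∣1 prime∤1
  prime∣^⇒∣ s (ℕ.suc e) q∣s^e with prime∣*⇒∣⊎∣ s (s ^ e) q∣s^e
  ... | inj₁ q∣s   = q∣s
  ... | inj₂ q∣s^e = prime∣^⇒∣ s e q∣s^e

  module _ {s : ℤ} (s≢0 : ¬ (s ≡ + 0 [mod q ])) {m : ℕ} (ord : IsOrd q s m) where

    ^-+-≢-mod : ∀ a {o} → 0 ℕ.< o → a ℕ.+ o ℕ.< m → ¬ ((s ^ (a ℕ.+ o)) ≡ s ^ a [mod q ])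
    ^-+-≢-mod a {o} 0<o a+o<m s^[a+o]≡s^a
      with prime∣*⇒∣⊎∣ (s ^ a) (s ^ o ℤ.- + 1) (subst (+ q ∣_) factor s^[a+o]≡s^a)
      where
      factor : s ^ (a ℕ.+ o) ℤ.- s ^ a ≡ s ^ a * (s ^ o ℤ.- + 1)
      factor = trans (cong (ℤ._- s ^ a) (ℤ.^-distribˡ-+-* s a o))
        (solve 2 (λ x y → x :* y :- x := x :* (y :- con (+ 1))) refl (s ^ a) (s ^ o))
    ... | inj₁ q∣s^a = s≢0 (subst (+ q ∣_) (sym (ℤ.+-identityʳ s)) (prime∣^⇒∣ s a q∣s^a))
    ... | inj₂ s^o≡1 = proj₂ (proj₂ ord) o 0<o (ℕ.≤-<-trans (ℕ.m≤n+m o a) a+o<m) s^o≡1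

    ^-<-≢-mod : ∀ {a b} → a ℕ.< b → b ℕ.< m → ¬ ((s ^ b) ≡ s ^ a [mod q ])
    ^-<-≢-mod {a} a<b b<m with ℕ.m≤n⇒∃[o]m+o≡n (ℕ.<⇒≤ a<b)
    ... | o , refl = ^-+-≢-mod a 0<o b<m
      where
      0<o : 0 ℕ.< o
      0<o = ℕ.+-cancelˡ-< a 0 o (subst (ℕ._< a ℕ.+ o) (sym (ℕ.+-identityʳ a)) a<b)

    ^-injective-mod : ∀ {a b} → a ℕ.< m → b ℕ.< m → (s ^ a) ≡ s ^ b [mod q ] → a ≡ b
    ^-injective-mod {a} {b} a<m b<m s^a≡s^b with ℕ.<-cmp a b
    ... | tri< a<b _ _ = contradiction (≡-mod-sym (s ^ a) (s ^ b) s^a≡s^b) (^-<-≢-mod a<b b<m)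
    ... | tri≈ _ a≡b _ = a≡b
    ... | tri> _ _ b<a = contradiction s^a≡s^b (^-<-≢-mod b<a a<m)

swap-difference : ∀ E ai aj si sj →
  ((E + ai * si) + aj * sj) ℤ.- (ai * sj + aj * si + E) ≡ (ai ℤ.- aj) * (si ℤ.- sj)
swap-difference = solve 5 (λ E ai aj si sj →
  ((E :+ ai :* si) :+ aj :* sj) :- (ai :* sj :+ aj :* si :+ E) := (ai :- aj) :* (si :- sj)) refl

lemma3p4 : (q : ℕ) → Prime q → (s : ℤ) → ¬ (s ≡ + 0 [mod q ]) →
    (m : ℕ) → IsOrd q s m → (a : Fin m → ℤ) → (i j : Fin m) →
    ¬ (a i ≡ a j [mod q ]) →
    let lhs = ∑ m (λ k → a k * s ^ toℕ k)
        rhs = a i * s ^ toℕ j + a j * s ^ toℕ i + ∑-except m i j (λ k → a k * s ^ toℕ k)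
    in ¬ (lhs ≡ rhs [mod q ])
       × ((lhs ≡ + 0 [mod q ] → ¬ (rhs ≡ + 0 [mod q ]))
         × (rhs ≡ + 0 [mod q ] → ¬ (lhs ≡ + 0 [mod q ])))
lemma3p4 q q-prime s s≢0 m ord a i j ai≢aj =
  lhs≢rhs , (λ l r → lhs≢rhs (≡0∧≡0⇒≡ lhs rhs l r)) , (λ r l → lhs≢rhs (≡0∧≡0⇒≡ lhs rhs l r))
  where
  f : Fin m → ℤ
  f k = a k * s ^ toℕ k
  lhs rhs : ℤ
  lhs = ∑ m f
  rhs = a i * s ^ toℕ j + a j * s ^ toℕ i + ∑-except m i j f
  i≢j : i ≢ j
  i≢j refl = ai≢aj (≡-mod-refl (a i))
  lhs-rhs : lhs ℤ.- rhs ≡ (a i ℤ.- a j) * (s ^ toℕ i ℤ.- s ^ toℕ j)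
  lhs-rhs = trans (cong (ℤ._- rhs) (∑≡∑-except+ m f i≢j))
                  (swap-difference (∑-except m i j f) (a i) (a j) (s ^ toℕ i) (s ^ toℕ j))
  lhs≢rhs : ¬ (lhs ≡ rhs [mod q ])
  lhs≢rhs lhs≡rhs with prime∣*⇒∣⊎∣ q-prime (a i ℤ.- a j) (s ^ toℕ i ℤ.- s ^ toℕ j)
                         (subst (+ q ∣_) lhs-rhs lhs≡rhs)
  ... | inj₁ ai≡aj   = ai≢aj ai≡aj
  ... | inj₂ s^i≡s^j =
    i≢j (toℕ-injective (^-injective-mod q-prime s≢0 ord (toℕ<n i) (toℕ<n j) s^i≡s^j))
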